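{- For every positive integer $n$, \[m_7(C_3,C_3,nK_2)=\begin{cases}\lfloor\frac{2n}{3}\rfloor+1 & \text{if } n \text{ is not a multiple of } 3,\\ \lfloor\frac{2n}{3}\rfloor & \text{otherwise.}\end{cases}\]
   Context: $K_{j\times t}$ denotes the complete multipartite graph with $j$ partite sets, each of size $t$. For graphs $H_1,\ldots,H_k$, the multipartite Ramsey number $m_j(H_1,\ldots,H_k)$ is the smallest positive integer $t$ such that for every $k$-edge-coloring $(G^1,\ldots,G^k)$ of $K_{j\times t}$ (partition of its edges into spanning subgraphs), some $G^\ell$ contains a copy of $H_\ell$; it is $\infty$ if no such $t$ exists. $C_3$ is the triangle and $nK_2$ is a matching of $n$ edges. -}

module Defs where

open import Level using (0ℓ)
open import Data.Nat using (ℕ; zero; suc; _+_; _*_; _≤_; _<_)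
open import Data.Nat.DivMod using (_/_; _%_)
open import Data.Fin using (Fin)
open import Data.Product using (_×_; _,_; proj₁; Σ; ∃)
open import Data.Empty using (⊥)
open import Relation.Nullary using (¬_; yes; no)
open import Relation.Binary.PropositionalEquality using (_≡_; _≢_)
open import Function.Definitions using (Injective)
open import Data.Nat.Properties using (_≟_)

record Graph : Set₁ where
  field
    V : Set
    E : V → V → Set
open Graph public

-- Vertices of K_{j×t}: (part index, index within part).
KV : ℕ → ℕ → Set
KV j t = Fin j × Fin t

KAdj : ∀ {j t} → KV j t → KV j t → Set
KAdj u v = proj₁ u ≢ proj₁ v

-- A k-edge-colouring of K_{j×t}: a symmetric colour assignment to pairs
-- (only the values on edges, i.e. pairs in different parts, matter).
-- Colour class ℓ is the spanning subgraph G^ℓ.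
record Colouring (k j t : ℕ) : Set where
  field
    col : KV j t → KV j t → Fin k
    sym : ∀ u v → col u v ≡ col v u
open Colouring public

ContainsIn : ∀ {k j t} → Colouring k j t → Fin k → Graph → Set
ContainsIn {k} {j} {t} c ℓ H =
  Σ (V H → KV j t) λ φ →
    Injective _≡_ _≡_ φ ×
    (∀ x y → E H x y → KAdj (φ x) (φ y) × col c (φ x) (φ y) ≡ ℓ)

Arrows : (j t k : ℕ) → (Fin k → Graph) → Set
Arrows j t k Hs = (c : Colouring k j t) → ∃ λ ℓ → ContainsIn c ℓ (Hs ℓ)

MultipartiteRamseyIs : (j k : ℕ) → (Fin k → Graph) → ℕ → Set
MultipartiteRamseyIs j k Hs m =
  1 ≤ m × Arrows j m k Hs × (∀ t → 1 ≤ t → t < m → ¬ Arrows j t k Hs)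

C3 : Graph
C3 = record { V = Fin 3 ; E = λ x y → x ≢ y }

matching : ℕ → Graph
matching n = record
  { V = Fin n × Fin 2
  ; E = λ u v → proj₁ u ≡ proj₁ v × proj₂' u ≢ proj₂' v }
  where
  proj₂' : Fin n × Fin 2 → Fin 2
  proj₂' (_ , b) = b

C3C3nK2 : ℕ → Fin 3 → Graph
C3C3nK2 n Fin.zero = C3
C3C3nK2 n (Fin.suc Fin.zero) = C3
C3C3nK2 n (Fin.suc (Fin.suc Fin.zero)) = matching n

formula : ℕ → ℕ
formula n with n % 3 ≟ 0
... | yes _ = (2 * n) / 3
... | no _ = (2 * n) / 3 + 1

-- Lower bound: merge parts 0, 1, 2 of K_{7×t} into one class and keep the other four parts as
-- classes of their own.  Colour edges between the five classes like the 5-cycle/pentagram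
-- colouring of K5, which has no monochromatic triangle, and edges inside the merged class with
-- colour 2.  Colour-2 edges then stay among the 3t vertices of three parts, so no colour-2 nK2
-- exists when 3t < 2n.
--
-- Upper bound: call the vertices with a fixed second coordinate a layer.  By R(3,3) = 6, six
-- vertices in distinct parts span a triangle of colour 0 or 1 or a colour-2 edge.  So one layer
-- yields a colour-2 edge, and two layers yield three disjoint ones: an edge (a,l₀)(b,l₀), an edge
-- in layer l₁ away from part a, and an edge among the parts other than b, taken in layer l₀ at
-- the two parts of the second edge and in layer l₁ elsewhere.  T layers thus carry a colour-2
-- matching with ⌊3T/2⌋ edges, at least n once 2n ≤ 3T.  Hence m₇(C₃,C₃,nK₂) = ⌈2n/3⌉, which is
-- the stated formula.

module Submission where

open import Level using (0ℓ)
open import Defs renaming (sym to col-sym)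
open import Data.Bool using (Bool; true; false; not)
open import Data.Bool.Properties using (¬-not) renaming (_≟_ to _≟ᵇ_)
open import Data.Nat using (ℕ; zero; suc; _+_; _*_; _≤_; _<_; z≤n; s≤s; s≤s⁻¹; ∣_-_∣)
open import Data.Nat.Properties using (≤-reflexive; m≤n+m; 1+n≢n; <⇒≱; *-comm; ≤-refl; ≤-trans; n≤1+n; ≤-pred; *-suc; *-distribˡ-+; +-monoʳ-≤; *-monoʳ-≤; *-cancelˡ-<; ∣-∣-comm; module ≤-Reasoning) renaming (_≟_ to _≟ℕ_; _<?_ to _<?ℕ_)
open import Data.Nat.DivMod using (_/_; _%_; +-distrib-/-∣ˡ)
open import Data.Nat.Divisibility using (divides)
open import Data.Fin using (Fin; zero; suc; #_; toℕ; fromℕ<; inject₁; inject≤; punchIn; splitAt; _≟_)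
open import Data.Fin.Properties using (toℕ-injective; toℕ-fromℕ<; inject₁-injective; inject≤-injective; punchIn-injective; punchInᵢ≢i; suc-injective; injective⇒≤; +↔⊎; *↔×; all?)
open import Data.Product using (_×_; _,_; proj₁; proj₂; ∃; ∃₂; map₁)
open import Data.Product.Properties using (,-injective)
open import Data.Sum using (_⊎_; inj₁; inj₂; [_,_]′)
import Data.Sum as Sum
open import Data.Sum.Effectful.Left using (monad)
open import Data.Empty using (⊥-elim)
open import Effect.Monad using (RawMonad)
open import Function using (_∘_; const)
open import Function.Bundles using (Injection)
open import Function.Definitions using (Injective)
open import Function.Properties.Inverse using (↔⇒↣; ↔-sym)
open import Relation.Binary.Definitions using (Symmetric)
open import Relation.Binary.PropositionalEquality using (_≡_; _≢_; refl; sym; trans; cong; cong₂; subst)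
open import Relation.Nullary using (¬_; yes; no; ¬?)
open import Relation.Nullary.Decidable using (toWitness; _⊎-dec_; _→-dec_)
open import Relation.Unary using (Pred; _⊆_; _∪_; _⊥_; _∉_; ｛_｝)

2[3+n]/3≡2+2n/3 : ∀ n → (2 * (3 + n)) / 3 ≡ 2 + (2 * n) / 3
2[3+n]/3≡2+2n/3 n = trans (cong (_/ 3) (*-distribˡ-+ 2 3 n)) (+-distrib-/-∣ˡ {m = 6} (2 * n) {d = 3} (divides 2 refl))

formula-+3 : ∀ n → formula (3 + n) ≡ 2 + formula n
formula-+3 n with n % 3 ≟ℕ 0
... | yes _ = 2[3+n]/3≡2+2n/3 n
... | no _ = cong (_+ 1) (2[3+n]/3≡2+2n/3 n)

2n≤3*formula : ∀ n → 2 * n ≤ 3 * formula n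
2n≤3*formula 0 = z≤n
2n≤3*formula 1 = s≤s (s≤s z≤n)
2n≤3*formula 2 = s≤s (s≤s (s≤s (s≤s z≤n)))
2n≤3*formula (suc (suc (suc n))) = begin
  2 * (3 + n)          ≡⟨ *-distribˡ-+ 2 3 n ⟩
  6 + 2 * n            ≤⟨ +-monoʳ-≤ 6 (2n≤3*formula n) ⟩
  6 + 3 * formula n    ≡⟨ *-distribˡ-+ 3 2 (formula n) ⟨
  3 * (2 + formula n)  ≡⟨ cong (3 *_) (formula-+3 n) ⟨
  3 * formula (3 + n)  ∎
  where open ≤-Reasoning

3*formula≤2+2n : ∀ n → 3 * formula n ≤ 2 + 2 * n
3*formula≤2+2n 0 = z≤n
3*formula≤2+2n 1 = s≤s (s≤s (s≤s z≤n))
3*formula≤2+2n 2 = ≤-refl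
3*formula≤2+2n (suc (suc (suc n))) = begin
  3 * formula (3 + n)  ≡⟨ cong (3 *_) (formula-+3 n) ⟩
  3 * (2 + formula n)  ≡⟨ *-distribˡ-+ 3 2 (formula n) ⟩
  6 + 3 * formula n    ≤⟨ +-monoʳ-≤ 6 (3*formula≤2+2n n) ⟩
  6 + (2 + 2 * n)      ≡⟨ cong (2 +_) (*-distribˡ-+ 2 3 n) ⟨
  2 + 2 * (3 + n)      ∎
  where open ≤-Reasoning

formula-pos : ∀ {n} → 1 ≤ n → 1 ≤ formula n
formula-pos {suc n} _ with formula (suc n) | 2n≤3*formula (suc n)
... | zero  | ()
... | suc _ | _ = s≤s z≤n

<formula⇒3t<2n : ∀ {n t} → t < formula n → 3 * t < 2 * n
<formula⇒3t<2n {n} {t} t<f = ≤-pred (≤-pred (begin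
  3 + 3 * t      ≡⟨ *-suc 3 t ⟨
  3 * suc t      ≤⟨ *-monoʳ-≤ 3 t<f ⟩
  3 * formula n  ≤⟨ 3*formula≤2+2n n ⟩
  2 + 2 * n      ∎))
  where open ≤-Reasoning

⌊3/2·_⌋ : ℕ → ℕ
⌊3/2· 0 ⌋ = 0
⌊3/2· 1 ⌋ = 1
⌊3/2· suc (suc t) ⌋ = 3 + ⌊3/2· t ⌋

3t≤1+2⌊3/2·t⌋ : ∀ t → 3 * t ≤ 1 + 2 * ⌊3/2· t ⌋
3t≤1+2⌊3/2·t⌋ 0 = z≤n
3t≤1+2⌊3/2·t⌋ 1 = ≤-refl
3t≤1+2⌊3/2·t⌋ (suc (suc t)) = begin
  3 * (2 + t)                  ≡⟨ *-distribˡ-+ 3 2 t ⟩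
  6 + 3 * t                    ≤⟨ +-monoʳ-≤ 6 (3t≤1+2⌊3/2·t⌋ t) ⟩
  6 + (1 + 2 * ⌊3/2· t ⌋)      ≡⟨ cong suc (*-distribˡ-+ 2 3 ⌊3/2· t ⌋) ⟨
  1 + 2 * (3 + ⌊3/2· t ⌋)      ∎
  where open ≤-Reasoning

2n≤3t⇒n≤⌊3/2·t⌋ : ∀ {n t} → 2 * n ≤ 3 * t → n ≤ ⌊3/2· t ⌋
2n≤3t⇒n≤⌊3/2·t⌋ {n} {t} 2n≤3t = s≤s⁻¹ (*-cancelˡ-< 2 n (suc ⌊3/2· t ⌋) (begin-strict
  2 * n                  ≤⟨ 2n≤3t ⟩
  3 * t                  ≤⟨ 3t≤1+2⌊3/2·t⌋ t ⟩
  1 + 2 * ⌊3/2· t ⌋      <⟨ ≤-refl ⟩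
  2 + 2 * ⌊3/2· t ⌋      ≡⟨ *-suc 2 ⌊3/2· t ⌋ ⟨
  2 * suc ⌊3/2· t ⌋      ∎))
  where open ≤-Reasoning

×-injective⇒≤ : ∀ {m n p q} {f : Fin m × Fin n → Fin p × Fin q} → Injective _≡_ _≡_ f → m * n ≤ p * q
×-injective⇒≤ {p = p} {q} f-inj =
  injective⇒≤ (Injection.injective (↔⇒↣ *↔×) ∘ f-inj ∘ Injection.injective (↔⇒↣ (↔-sym (*↔× {p} {q}))))

record Triple {A : Set} (P : A → Set) : Set where
  constructor triple
  field
    x y z : A
    x≢y : x ≢ y
    x≢z : x ≢ z
    y≢z : y ≢ z
    px : P x
    py : P y
    pz : P z

record Triangle {A C : Set} (χ : A → A → C) (γ : C) : Set where
  constructor triangle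
  field
    a b d : A
    a≢b : a ≢ b
    a≢d : a ≢ d
    b≢d : b ≢ d
    ab : χ a b ≡ γ
    ad : χ a d ≡ γ
    bd : χ b d ≡ γ

-- Compare every value with f 0: one differing from it equals not (f 0).
threeAgree : (f : Fin 5 → Bool) → ∃ λ γ → Triple (λ i → f i ≡ γ)
threeAgree f with f (# 1) ≟ᵇ f (# 0) | f (# 2) ≟ᵇ f (# 0) | f (# 3) ≟ᵇ f (# 0) | f (# 4) ≟ᵇ f (# 0)
... | yes e₁ | yes e₂ | _      | _      = f (# 0) , triple (# 0) (# 1) (# 2) (λ ()) (λ ()) (λ ()) refl e₁ e₂
... | yes e₁ | no _   | yes e₃ | _      = f (# 0) , triple (# 0) (# 1) (# 3) (λ ()) (λ ()) (λ ()) refl e₁ e₃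
... | yes e₁ | no _   | no _   | yes e₄ = f (# 0) , triple (# 0) (# 1) (# 4) (λ ()) (λ ()) (λ ()) refl e₁ e₄
... | yes _  | no n₂  | no n₃  | no n₄  = not (f (# 0)) , triple (# 2) (# 3) (# 4) (λ ()) (λ ()) (λ ()) (¬-not n₂) (¬-not n₃) (¬-not n₄)
... | no _   | yes e₂ | yes e₃ | _      = f (# 0) , triple (# 0) (# 2) (# 3) (λ ()) (λ ()) (λ ()) refl e₂ e₃
... | no _   | yes e₂ | no _   | yes e₄ = f (# 0) , triple (# 0) (# 2) (# 4) (λ ()) (λ ()) (λ ()) refl e₂ e₄
... | no n₁  | yes _  | no n₃  | no n₄  = not (f (# 0)) , triple (# 1) (# 3) (# 4) (λ ()) (λ ()) (λ ()) (¬-not n₁) (¬-not n₃) (¬-not n₄)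
... | no _   | no _   | yes e₃ | yes e₄ = f (# 0) , triple (# 0) (# 3) (# 4) (λ ()) (λ ()) (λ ()) refl e₃ e₄
... | no n₁  | no n₂  | yes _  | no n₄  = not (f (# 0)) , triple (# 1) (# 2) (# 4) (λ ()) (λ ()) (λ ()) (¬-not n₁) (¬-not n₂) (¬-not n₄)
... | no n₁  | no n₂  | no n₃  | _      = not (f (# 0)) , triple (# 1) (# 2) (# 3) (λ ()) (λ ()) (λ ()) (¬-not n₁) (¬-not n₂) (¬-not n₃)

-- Three neighbours of vertex 0 share a colour γ; unless two of them are joined in colour γ,
-- they span a triangle in the other colour.
ramsey₃₃ : (χ : Fin 6 → Fin 6 → Bool) → ∃ (Triangle χ)
ramsey₃₃ χ with threeAgree (λ i → χ zero (suc i))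
... | γ , triple i j k i≢j i≢k j≢k χ0i χ0j χ0k
  with χ (suc i) (suc j) ≟ᵇ γ | χ (suc i) (suc k) ≟ᵇ γ | χ (suc j) (suc k) ≟ᵇ γ
... | yes ij | _      | _      = γ , triangle zero (suc i) (suc j) (λ ()) (λ ()) (i≢j ∘ suc-injective) χ0i χ0j ij
... | no _   | yes ik | _      = γ , triangle zero (suc i) (suc k) (λ ()) (λ ()) (i≢k ∘ suc-injective) χ0i χ0k ik
... | no _   | no _   | yes jk = γ , triangle zero (suc j) (suc k) (λ ()) (λ ()) (j≢k ∘ suc-injective) χ0j χ0k jk
... | no ij  | no ik  | no jk  =
  not γ , triangle (suc i) (suc j) (suc k) (i≢j ∘ suc-injective) (i≢k ∘ suc-injective) (j≢k ∘ suc-injective)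
                   (¬-not ij) (¬-not ik) (¬-not jk)

isRed : Fin 3 → Bool
isRed zero = true
isRed (suc _) = false

isRed⇒≡0 : ∀ {γ} → isRed γ ≡ true → γ ≡ # 0
isRed⇒≡0 {zero} _ = refl

¬isRed⇒≡1⊎≡2 : ∀ {γ} → isRed γ ≡ false → γ ≡ # 1 ⊎ γ ≡ # 2
¬isRed⇒≡1⊎≡2 {suc zero} _ = inj₁ refl
¬isRed⇒≡1⊎≡2 {suc (suc zero)} _ = inj₂ refl

-- Apply R(3,3) to "colour 0 or not": a triangle avoiding colour 0 has an edge of colour 2
-- or is a triangle of colour 1.
triangleOrEdge₂ : (κ : Fin 6 → Fin 6 → Fin 3) →
                  (Triangle κ (# 0) ⊎ Triangle κ (# 1)) ⊎ ∃₂ λ x y → x ≢ y × κ x y ≡ # 2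
triangleOrEdge₂ κ with ramsey₃₃ (λ x y → isRed (κ x y))
... | true , triangle a b d a≢b a≢d b≢d ab ad bd =
  inj₁ (inj₁ (triangle a b d a≢b a≢d b≢d (isRed⇒≡0 ab) (isRed⇒≡0 ad) (isRed⇒≡0 bd)))
... | false , triangle a b d a≢b a≢d b≢d ab ad bd
  with ¬isRed⇒≡1⊎≡2 ab | ¬isRed⇒≡1⊎≡2 ad | ¬isRed⇒≡1⊎≡2 bd
... | inj₂ ab₂ | _        | _        = inj₂ (a , b , a≢b , ab₂)
... | _        | inj₂ ad₂ | _        = inj₂ (a , d , a≢d , ad₂)
... | _        | _        | inj₂ bd₂ = inj₂ (b , d , b≢d , bd₂)
... | inj₁ ab₁ | inj₁ ad₁ | inj₁ bd₁ = inj₁ (inj₂ (triangle a b d a≢b a≢d b≢d ab₁ ad₁ bd₁))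

onDistinctPairs₃ : {R : Fin 3 → Fin 3 → Set} → Symmetric R →
                   R (# 0) (# 1) → R (# 0) (# 2) → R (# 1) (# 2) → ∀ x y → x ≢ y → R x y
onDistinctPairs₃ R-sym r₀₁ r₀₂ r₁₂ zero             zero             x≢y = ⊥-elim (x≢y refl)
onDistinctPairs₃ R-sym r₀₁ r₀₂ r₁₂ zero             (suc zero)       _   = r₀₁
onDistinctPairs₃ R-sym r₀₁ r₀₂ r₁₂ zero             (suc (suc zero)) _   = r₀₂
onDistinctPairs₃ R-sym r₀₁ r₀₂ r₁₂ (suc zero)       zero             _   = R-sym r₀₁
onDistinctPairs₃ R-sym r₀₁ r₀₂ r₁₂ (suc zero)       (suc zero)       x≢y = ⊥-elim (x≢y refl)
onDistinctPairs₃ R-sym r₀₁ r₀₂ r₁₂ (suc zero)       (suc (suc zero)) _   = r₁₂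
onDistinctPairs₃ R-sym r₀₁ r₀₂ r₁₂ (suc (suc zero)) zero             _   = R-sym r₀₂
onDistinctPairs₃ R-sym r₀₁ r₀₂ r₁₂ (suc (suc zero)) (suc zero)       _   = R-sym r₁₂
onDistinctPairs₃ R-sym r₀₁ r₀₂ r₁₂ (suc (suc zero)) (suc (suc zero)) x≢y = ⊥-elim (x≢y refl)

Triangle⇒C3 : ∀ {k j t} (c : Colouring k j t) {A : Set} {ℓ} (h : A → KV j t) → Injective _≡_ _≡_ (proj₁ ∘ h) →
              Triangle (λ x y → col c (h x) (h y)) ℓ → ContainsIn c ℓ C3
Triangle⇒C3 {j = j} {t} c {A} {ℓ} h h-inj (triangle a b d a≢b a≢d b≢d ab ad bd) = φ , φ-injective , edges
  where
  τ : Fin 3 → A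
  τ zero = a
  τ (suc zero) = b
  τ (suc (suc zero)) = d
  τ-≢ : ∀ x y → x ≢ y → τ x ≢ τ y
  τ-≢ = onDistinctPairs₃ (λ x≢y → x≢y ∘ sym) a≢b a≢d b≢d
  φ : Fin 3 → KV j t
  φ = h ∘ τ
  φ-injective : Injective _≡_ _≡_ φ
  φ-injective {x} {y} φx≡φy with x ≟ y
  ... | yes x≡y = x≡y
  ... | no x≢y = ⊥-elim (τ-≢ x y x≢y (h-inj (cong proj₁ φx≡φy)))
  edges : ∀ x y → x ≢ y → KAdj (φ x) (φ y) × col c (φ x) (φ y) ≡ ℓ
  edges x y x≢y = τ-≢ x y x≢y ∘ h-inj , onDistinctPairs₃ (trans (col-sym c _ _)) ab ad bd x y x≢y

module Matchings {k j t} (c : Colouring k j t) (ℓ : Fin k) where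

  Edge : KV j t → KV j t → Set
  Edge u v = KAdj u v × col c u v ≡ ℓ

  Edge-sym : ∀ {u v} → Edge u v → Edge v u
  Edge-sym {u} {v} (u≁v , uv) = u≁v ∘ sym , trans (col-sym c v u) uv

  record Matching (s : ℕ) (P : Pred (KV j t) 0ℓ) : Set where
    field
      endpoint : Fin s × Fin 2 → KV j t
      injective : Injective _≡_ _≡_ endpoint
      edge : ∀ i → Edge (endpoint (i , # 0)) (endpoint (i , # 1))
      within : ∀ x → P (endpoint x)
  open Matching

  mono : ∀ {s} {P Q : Pred (KV j t) 0ℓ} → P ⊆ Q → Matching s P → Matching s Q
  mono P⊆Q M = record { endpoint = endpoint M ; injective = injective M ; edge = edge M ; within = P⊆Q ∘ within M }

  ∅-matching : ∀ {P} → Matching 0 P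
  ∅-matching = record { endpoint = λ () ; injective = λ { {()} } ; edge = λ () ; within = λ () }

  edge-matching : ∀ {u v} → Edge u v → Matching 1 (｛ u ｝ ∪ ｛ v ｝)
  edge-matching {u} {v} e = record { endpoint = ends ; injective = ends-injective ; edge = λ { zero → e } ; within = ends-within }
    where
    ends : Fin 1 × Fin 2 → KV j t
    ends (_ , zero) = u
    ends (_ , suc zero) = v
    ends-injective : Injective _≡_ _≡_ ends
    ends-injective {zero , zero}     {zero , zero}     _   = refl
    ends-injective {zero , zero}     {zero , suc zero} u≡v = ⊥-elim (proj₁ e (cong proj₁ u≡v))
    ends-injective {zero , suc zero} {zero , zero}     v≡u = ⊥-elim (proj₁ e (cong proj₁ (sym v≡u)))
    ends-injective {zero , suc zero} {zero , suc zero} _   = refl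
    ends-within : ∀ x → (｛ u ｝ ∪ ｛ v ｝) (ends x)
    ends-within (_ , zero) = inj₁ refl
    ends-within (_ , suc zero) = inj₂ refl

  union : ∀ {s r} {P Q : Pred (KV j t) 0ℓ} → P ⊥ Q → Matching s P → Matching r Q → Matching (s + r) (P ∪ Q)
  union {s} {r} {P} {Q} P⊥Q M N = record
    { endpoint = λ (i , b) → ends (splitAt s i) b
    ; injective = λ {(i , b)} {(i′ , b′)} eq →
        let i≡i′ , b≡b′ = ends-injective (splitAt s i) (splitAt s i′) eq
        in cong₂ _,_ (Injection.injective (↔⇒↣ (+↔⊎ {s} {r})) i≡i′) b≡b′
    ; edge = λ i → ends-edge (splitAt s i)
    ; within = λ (i , b) → ends-within (splitAt s i) b
    }
    where
    ends : Fin s ⊎ Fin r → Fin 2 → KV j t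
    ends (inj₁ i) b = endpoint M (i , b)
    ends (inj₂ i) b = endpoint N (i , b)
    ends-edge : ∀ x → Edge (ends x (# 0)) (ends x (# 1))
    ends-edge (inj₁ i) = edge M i
    ends-edge (inj₂ i) = edge N i
    ends-within : ∀ x b → (P ∪ Q) (ends x b)
    ends-within (inj₁ i) b = inj₁ (within M (i , b))
    ends-within (inj₂ i) b = inj₂ (within N (i , b))
    ends-injective : ∀ x y {b b′} → ends x b ≡ ends y b′ → x ≡ y × b ≡ b′
    ends-injective (inj₁ i) (inj₁ i′) eq = map₁ (cong inj₁) (,-injective (injective M eq))
    ends-injective (inj₂ i) (inj₂ i′) eq = map₁ (cong inj₂) (,-injective (injective N eq))
    ends-injective (inj₁ i) (inj₂ i′) {b} {b′} eq = ⊥-elim (P⊥Q (within M (i , b) , subst Q (sym eq) (within N (i′ , b′))))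
    ends-injective (inj₂ i) (inj₁ i′) {b} {b′} eq = ⊥-elim (P⊥Q (within M (i′ , b′) , subst Q eq (within N (i , b))))

  Matching⇒ContainsIn : ∀ {n s P} → n ≤ s → Matching s P → ContainsIn c ℓ (matching n)
  Matching⇒ContainsIn {n} n≤s M = φ , φ-injective , edges
    where
    φ : Fin n × Fin 2 → KV j t
    φ (i , b) = endpoint M (inject≤ i n≤s , b)
    φ-injective : Injective _≡_ _≡_ φ
    φ-injective {i , b} {i′ , b′} eq =
      let i≡i′ , b≡b′ = ,-injective (injective M eq)
      in cong₂ _,_ (inject≤-injective n≤s n≤s i i′ i≡i′) b≡b′
    edges : ∀ x y → E (matching n) x y → Edge (φ x) (φ y)
    edges (i , zero)     (.i , zero)     (refl , 0≢0) = ⊥-elim (0≢0 refl)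
    edges (i , zero)     (.i , suc zero) (refl , _)   = edge M (inject≤ i n≤s)
    edges (i , suc zero) (.i , zero)     (refl , _)   = Edge-sym (edge M (inject≤ i n≤s))
    edges (i , suc zero) (.i , suc zero) (refl , 1≢1) = ⊥-elim (1≢1 refl)

  -- If every ℓ-coloured edge starts in one of the first r parts, the 2n matched vertices
  -- inject into the r·t vertices of those parts.
  ContainsIn⇒≤ : ∀ {n r} → (∀ {u v} → Edge u v → toℕ (proj₁ u) < r) → ContainsIn c ℓ (matching n) → n * 2 ≤ r * t
  ContainsIn⇒≤ {n} {r} low (φ , φ-injective , edges) = ×-injective⇒≤ ψ-injective
    where
    partner : Fin n × Fin 2 → Fin n × Fin 2
    partner (i , zero) = i , # 1
    partner (i , suc zero) = i , # 0
    partner-edge : ∀ x → E (matching n) x (partner x)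
    partner-edge (i , zero) = refl , λ ()
    partner-edge (i , suc zero) = refl , λ ()
    inLowPart : ∀ x → toℕ (proj₁ (φ x)) < r
    inLowPart x = low (edges x (partner x) (partner-edge x))
    ψ : Fin n × Fin 2 → Fin r × Fin t
    ψ x = fromℕ< (inLowPart x) , proj₂ (φ x)
    ψ-injective : Injective _≡_ _≡_ ψ
    ψ-injective {x} {y} eq = φ-injective (cong₂ _,_ (toℕ-injective part≡) (proj₂ (,-injective eq)))
      where
      part≡ : toℕ (proj₁ (φ x)) ≡ toℕ (proj₁ (φ y))
      part≡ = trans (sym (toℕ-fromℕ< (inLowPart x))) (trans (cong toℕ (proj₁ (,-injective eq))) (toℕ-fromℕ< (inLowPart y)))

partClass : Fin 7 → Fin 5
partClass p = [ const zero , suc ]′ (splitAt 3 p)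

-- On K5, distances 1 and 4 span the 5-cycle (colour 0) and distances 2 and 3 the
-- pentagram (colour 1); neither contains a triangle.  Colour 2 joins vertices of one class.
colourAtDistance : ℕ → Fin 3
colourAtDistance 0 = # 2
colourAtDistance 1 = # 0
colourAtDistance 2 = # 1
colourAtDistance 3 = # 1
colourAtDistance (suc (suc (suc (suc _)))) = # 0

pentagon : Fin 5 → Fin 5 → Fin 3
pentagon x y = colourAtDistance ∣ toℕ x - toℕ y ∣

pentagon-triangle⇒2 : ∀ x y z → pentagon x y ≡ pentagon x z → pentagon x y ≡ pentagon y z → pentagon x y ≡ # 2
pentagon-triangle⇒2 = toWitness {a? = all? λ x → all? λ y → all? λ z →
  (pentagon x y ≟ pentagon x z) →-dec (pentagon x y ≟ pentagon y z) →-dec (pentagon x y ≟ # 2)} _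

pentagon-2⇒lowPart : ∀ p q → p ≢ q → pentagon (partClass p) (partClass q) ≡ # 2 → toℕ p < 3
pentagon-2⇒lowPart = toWitness {a? = all? λ p → all? λ q →
  ¬? (p ≟ q) →-dec (pentagon (partClass p) (partClass q) ≟ # 2) →-dec (toℕ p <?ℕ 3)} _

lowerColouring : (t : ℕ) → Colouring 3 7 t
lowerColouring t = record
  { col = λ u v → pentagon (partClass (proj₁ u)) (partClass (proj₁ v))
  ; sym = λ u v → cong colourAtDistance (∣-∣-comm (toℕ (partClass (proj₁ u))) (toℕ (partClass (proj₁ v))))
  }

noTriangle-lowerColouring : ∀ {t ℓ} → ℓ ≢ # 2 → ¬ ContainsIn (lowerColouring t) ℓ C3
noTriangle-lowerColouring {t} {ℓ} ℓ≢2 (φ , _ , edges) =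
  ℓ≢2 (trans (sym e₀₁) (pentagon-triangle⇒2 (class (# 0)) (class (# 1)) (class (# 2)) (trans e₀₁ (sym e₀₂)) (trans e₀₁ (sym e₁₂))))
  where
  class : Fin 3 → Fin 5
  class x = partClass (proj₁ (φ x))
  e₀₁ : pentagon (class (# 0)) (class (# 1)) ≡ ℓ
  e₀₁ = proj₂ (edges (# 0) (# 1) (λ ()))
  e₀₂ : pentagon (class (# 0)) (class (# 2)) ≡ ℓ
  e₀₂ = proj₂ (edges (# 0) (# 2) (λ ()))
  e₁₂ : pentagon (class (# 1)) (class (# 2)) ≡ ℓ
  e₁₂ = proj₂ (edges (# 1) (# 2) (λ ()))

lowerColouring-matching≤ : ∀ {n t} → ContainsIn (lowerColouring t) (# 2) (matching n) → n * 2 ≤ 3 * t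
lowerColouring-matching≤ {t = t} =
  Matchings.ContainsIn⇒≤ (lowerColouring t) (# 2) (λ (u≁v , uv) → pentagon-2⇒lowPart _ _ u≁v uv)

3t<2n⇒¬arrows : ∀ {n t} → 3 * t < 2 * n → ¬ Arrows 7 t 3 (C3C3nK2 n)
3t<2n⇒¬arrows {n} {t} 3t<2n arrows with arrows (lowerColouring t)
... | zero , red = noTriangle-lowerColouring (λ ()) red
... | suc zero , blue = noTriangle-lowerColouring (λ ()) blue
... | suc (suc zero) , green = <⇒≱ 3t<2n (subst (_≤ 3 * t) (*-comm n 2) (lowerColouring-matching≤ green))

module UpperBound {T : ℕ} (c : Colouring 3 7 T) where
  open Matchings c (# 2)

  RedOrBlueTriangle : Set
  RedOrBlueTriangle = ContainsIn c (# 0) C3 ⊎ ContainsIn c (# 1) C3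

  open RawMonad (monad RedOrBlueTriangle 0ℓ)

  InLayer : Fin T → Pred (KV 7 T) 0ℓ
  InLayer l w = proj₂ w ≡ l

  pair⊆InLayer : ∀ {a b l} → ｛ (a , l) ｝ ∪ ｛ (b , l) ｝ ⊆ InLayer l
  pair⊆InLayer (inj₁ refl) = refl
  pair⊆InLayer (inj₂ refl) = refl

  greenEdge : (h : Fin 6 → KV 7 T) → Injective _≡_ _≡_ (proj₁ ∘ h) → RedOrBlueTriangle ⊎ ∃₂ λ x y → Edge (h x) (h y)
  greenEdge h h-inj =
    Sum.map (Sum.map (Triangle⇒C3 c h h-inj) (Triangle⇒C3 c h h-inj))
            (λ (x , y , x≢y , xy) → x , y , x≢y ∘ h-inj , xy)
            (triangleOrEdge₂ (λ x y → col c (h x) (h y)))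

  oneLayer : (l : Fin T) → RedOrBlueTriangle ⊎ Matching 1 (InLayer l)
  oneLayer l = do
    x , y , e ← greenEdge (λ p → inject₁ p , l) inject₁-injective
    return (mono pair⊆InLayer (edge-matching e))

  module ThirdSix {l₀ l₁ : Fin T} (l₀≢l₁ : l₀ ≢ l₁) (b p q : Fin 7) where
    layerOf : Fin 7 → Fin T
    layerOf r with r ≟ p ⊎-dec r ≟ q
    ... | yes _ = l₀
    ... | no _ = l₁

    layerOf≡l₀ : ∀ {r} → layerOf r ≡ l₀ → r ≡ p ⊎ r ≡ q
    layerOf≡l₀ {r} eq with r ≟ p ⊎-dec r ≟ q
    ... | yes r∈pq = r∈pq
    ... | no _ = ⊥-elim (l₀≢l₁ (sym eq))

    layerOf≡l₁ : ∀ {r} → layerOf r ≡ l₁ → ¬ (r ≡ p ⊎ r ≡ q)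
    layerOf≡l₁ {r} eq with r ≟ p ⊎-dec r ≟ q
    ... | yes _ = ⊥-elim (l₀≢l₁ eq)
    ... | no r∉pq = r∉pq

    layerOf-InLayers : ∀ r → layerOf r ≡ l₀ ⊎ layerOf r ≡ l₁
    layerOf-InLayers r with r ≟ p ⊎-dec r ≟ q
    ... | yes _ = inj₁ refl
    ... | no _ = inj₂ refl

    vertex : Fin 6 → KV 7 T
    vertex i = punchIn b i , layerOf (punchIn b i)

    vertex-∉ : ∀ {a} → a ≢ p → a ≢ q → ∀ i →
               vertex i ∉ (｛ (a , l₀) ｝ ∪ ｛ (b , l₀) ｝) ∪ (｛ (p , l₁) ｝ ∪ ｛ (q , l₁) ｝)
    vertex-∉ a≢p a≢q i (inj₁ (inj₁ eq)) =
      [ a≢p ∘ trans (cong proj₁ eq) , a≢q ∘ trans (cong proj₁ eq) ]′ (layerOf≡l₀ (sym (cong proj₂ eq)))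
    vertex-∉ a≢p a≢q i (inj₁ (inj₂ eq)) = punchInᵢ≢i b i (sym (cong proj₁ eq))
    vertex-∉ a≢p a≢q i (inj₂ (inj₁ eq)) = layerOf≡l₁ (sym (cong proj₂ eq)) (inj₁ (sym (cong proj₁ eq)))
    vertex-∉ a≢p a≢q i (inj₂ (inj₂ eq)) = layerOf≡l₁ (sym (cong proj₂ eq)) (inj₂ (sym (cong proj₁ eq)))

    vertexPair⊆InLayers : ∀ {x y} → ｛ vertex x ｝ ∪ ｛ vertex y ｝ ⊆ InLayer l₀ ∪ InLayer l₁
    vertexPair⊆InLayers (inj₁ refl) = layerOf-InLayers _
    vertexPair⊆InLayers (inj₂ refl) = layerOf-InLayers _

  twoLayers : ∀ {l₀ l₁} → l₀ ≢ l₁ → RedOrBlueTriangle ⊎ Matching 3 (InLayer l₀ ∪ InLayer l₁)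
  twoLayers {l₀} {l₁} l₀≢l₁ = do
    x₁ , y₁ , e₁ ← greenEdge (λ i → inject₁ i , l₀) inject₁-injective
    let a = inject₁ x₁
        b = inject₁ y₁
    x₂ , y₂ , e₂ ← greenEdge (λ i → punchIn a i , l₁) (punchIn-injective a _ _)
    let open ThirdSix l₀≢l₁ b (punchIn a x₂) (punchIn a y₂)
    x₃ , y₃ , e₃ ← greenEdge vertex (punchIn-injective b _ _)
    let first₂ = union (λ (w₁ , w₂) → l₀≢l₁ (trans (sym (pair⊆InLayer w₁)) (pair⊆InLayer w₂)))
                       (edge-matching e₁) (edge-matching e₂)
        avoid = vertex-∉ (punchInᵢ≢i a x₂ ∘ sym) (punchInᵢ≢i a y₂ ∘ sym)
    return (mono [ [ inj₁ ∘ pair⊆InLayer , inj₂ ∘ pair⊆InLayer ]′ , vertexPair⊆InLayers ]′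
                 (union (λ { (w∈ , inj₁ refl) → avoid x₃ w∈ ; (w∈ , inj₂ refl) → avoid y₃ w∈ })
                        first₂ (edge-matching e₃)))

  Below : ℕ → Pred (KV 7 T) 0ℓ
  Below t w = toℕ (proj₂ w) < t

  ≡fromℕ<⇒toℕ≡ : ∀ {t} (t<T : t < T) {l} → l ≡ fromℕ< t<T → toℕ l ≡ t
  ≡fromℕ<⇒toℕ≡ t<T refl = toℕ-fromℕ< t<T

  matchingBelow : ∀ t → t ≤ T → RedOrBlueTriangle ⊎ Matching ⌊3/2· t ⌋ (Below t)
  matchingBelow 0 _ = return ∅-matching
  matchingBelow 1 1≤T = mono (≤-reflexive ∘ cong suc ∘ ≡fromℕ<⇒toℕ≡ {0} 1≤T) <$> oneLayer (fromℕ< 1≤T)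
  matchingBelow (suc (suc t)) 2+t≤T = do
    B ← twoLayers l₀≢l₁
    M ← matchingBelow t (≤-trans (m≤n+m t 2) 2+t≤T)
    return (mono [ proj₂ ∘ inLayers⇒range , (λ w<t → ≤-trans w<t (m≤n+m t 2)) ]′
                 (union (λ (w∈ , w<t) → <⇒≱ w<t (proj₁ (inLayers⇒range w∈))) B M))
    where
    t<T : t < T
    t<T = ≤-trans (n≤1+n (suc t)) 2+t≤T
    l₀ l₁ : Fin T
    l₀ = fromℕ< t<T
    l₁ = fromℕ< 2+t≤T
    l₀≢l₁ : l₀ ≢ l₁
    l₀≢l₁ l₀≡l₁ = 1+n≢n (trans (sym (toℕ-fromℕ< {suc t} 2+t≤T)) (trans (cong toℕ (sym l₀≡l₁)) (toℕ-fromℕ< {t} t<T)))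
    inLayers⇒range : ∀ {l} → l ≡ l₀ ⊎ l ≡ l₁ → t ≤ toℕ l × toℕ l < 2 + t
    inLayers⇒range (inj₁ l≡l₀) rewrite ≡fromℕ<⇒toℕ≡ {t} t<T l≡l₀ = ≤-refl , n≤1+n (suc t)
    inLayers⇒range (inj₂ l≡l₁) rewrite ≡fromℕ<⇒toℕ≡ {suc t} 2+t≤T l≡l₁ = n≤1+n t , ≤-refl

2n≤3T⇒arrows : ∀ {n T} → 2 * n ≤ 3 * T → Arrows 7 T 3 (C3C3nK2 n)
2n≤3T⇒arrows {n} {T} 2n≤3T c with UpperBound.matchingBelow c T ≤-refl
... | inj₁ (inj₁ red) = # 0 , red
... | inj₁ (inj₂ blue) = # 1 , blue
... | inj₂ M = # 2 , Matchings.Matching⇒ContainsIn c (# 2) (2n≤3t⇒n≤⌊3/2·t⌋ {n} {T} 2n≤3T) M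

theorem8 : (n : ℕ) → 1 ≤ n → MultipartiteRamseyIs 7 3 (C3C3nK2 n) (formula n)
theorem8 n 1≤n =
  formula-pos 1≤n , 2n≤3T⇒arrows (2n≤3*formula n) , λ t _ t<f → 3t<2n⇒¬arrows (<formula⇒3t<2n {n} {t} t<f)
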